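{- Let $\mathcal{H}$ be a 3-uniform hypergraph containing no copy of $\mathcal{M}$, and let $\mathcal{H}'$ be the 13-core of $\mathcal{H}$. Then there is a partition of $V(\mathcal{H}')$ into three sets $X, Y, Z$ and a partition of $Z$ into sets $(A_v : v \in Y)$ such that $\mathcal{H}'[X \cup Y]$ is a partial Steiner triple system and every triple $e \in \mathcal{H}'$ is of one of the following two forms: (i) $e \subseteq X \cup Y$; (ii) $e \cap Y = \{y\}$ for some $y \in Y$ and $e \setminus \{y\} \subseteq A_y$.
   Context: The messy path $\mathcal{M}$ is the 3-uniform hypergraph $\{abc, bcd, def\}$ on six distinct vertices. The degree of a vertex is the number of triples containing it. The $m$-core of a hypergraph is the subhypergraph obtained by iteratively deleting vertices of degree less than $m$ (together with their triples) until every remaining vertex has degree at least $m$ (or the hypergraph is empty). For $U \subseteq V$, $\mathcal{H}'[U]$ is the set of triples of $\mathcal{H}'$ contained in $U$. A partial Steiner triple system is a 3-uniform hypergraph in which every pair of vertices lies in at most one triple. -}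

module Defs where

open import Data.Nat using (ℕ; _≤_; _<_)
open import Data.Nat.Base using (_<ᵇ_)
open import Data.Bool using (Bool; true; false; _∧_)
open import Data.Fin using (Fin; toℕ)
open import Data.Fin.Subset using (Subset; _∈_; _-_; ⊤; _∪_)
open import Data.Vec using (lookup)
open import Data.List using (List; []; _∷_; length; filterᵇ; allFin; cartesianProduct)
open import Data.List.Relation.Unary.Unique.Propositional using (Unique)
open import Data.Product using (_×_; _,_; Σ; ∃; ∃-syntax)
open import Data.Sum using (_⊎_)
open import Relation.Binary.PropositionalEquality using (_≡_; _≢_)
open import Relation.Nullary using (¬_)

-- A triple {a,b,c} is an edge
-- iff  edge a b c ≡ true ; the function is symmetric in its arguments and
-- only true on triples of three distinct vertices.
record Hypergraph3 (n : ℕ) : Set where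
  field
    edge     : Fin n → Fin n → Fin n → Bool
    distinct : ∀ a b c → edge a b c ≡ true → (a ≢ b) × (b ≢ c) × (a ≢ c)
    sym₁₂    : ∀ a b c → edge a b c ≡ edge b a c
    sym₂₃    : ∀ a b c → edge a b c ≡ edge a c b
open Hypergraph3 public

IsEdge : ∀ {n} → Hypergraph3 n → Fin n → Fin n → Fin n → Set
IsEdge H a b c = edge H a b c ≡ true

-- Degree of v in the induced subhypergraph H[U]: the number of triples
-- {v,a,b} of H contained in U (counted via the pairs a<b); 0 if v ∉ U.
degIn : ∀ {n} → Hypergraph3 n → Subset n → Fin n → ℕ
degIn {n} H U v =
  length (filterᵇ ok (cartesianProduct (allFin n) (allFin n)))
  where
    ok : Fin n × Fin n → Bool
    ok (a , b) = lookup U v ∧ lookup U a ∧ lookup U b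
                 ∧ (toℕ a <ᵇ toℕ b) ∧ edge H v a b

-- CoreSeq H m U W means:
-- starting from the vertex set U (hypergraph H[U]) some sequence of
-- deletions of vertices of degree < m ends in W, where every vertex of W
-- has degree ≥ m in H[W] (so the process stops).
data CoreSeq {n : ℕ} (H : Hypergraph3 n) (m : ℕ) : Subset n → Subset n → Set where
  done : ∀ {U} → (∀ v → v ∈ U → m ≤ degIn H U v) → CoreSeq H m U U
  step : ∀ {U W} (v : Fin n) → v ∈ U → degIn H U v < m
         → CoreSeq H m (U - v) W → CoreSeq H m U W

-- W is the vertex set of the m-core of H; the m-core itself is H[W].
IsCoreVertexSet : ∀ {n} → Hypergraph3 n → ℕ → Subset n → Set
IsCoreVertexSet H m W = CoreSeq H m ⊤ W

ContainsMessyPath : ∀ {n} → Hypergraph3 n → Set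
ContainsMessyPath {n} H =
  ∃[ a ] ∃[ b ] ∃[ c ] ∃[ d ] ∃[ e ] Σ (Fin n) λ f →
    Unique (a ∷ b ∷ c ∷ d ∷ e ∷ f ∷ [])
    × IsEdge H a b c × IsEdge H b c d × IsEdge H d e f

EdgeIn : ∀ {n} → Hypergraph3 n → Subset n → Fin n → Fin n → Fin n → Set
EdgeIn H U a b c = IsEdge H a b c × a ∈ U × b ∈ U × c ∈ U

IsPartialSTS : ∀ {n} → Hypergraph3 n → Subset n → Set
IsPartialSTS H U = ∀ a b c c' → EdgeIn H U a b c → EdgeIn H U a b c' → c ≡ c'

IsPartition3 : ∀ {n} → Subset n → Subset n → Subset n → Subset n → Set
IsPartition3 {n} W X Y Z =
  (∀ (v : Fin n) → v ∈ W → (v ∈ X ⊎ v ∈ Y ⊎ v ∈ Z))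
  × (∀ v → v ∈ X → v ∈ W) × (∀ v → v ∈ Y → v ∈ W) × (∀ v → v ∈ Z → v ∈ W)
  × (∀ v → v ∈ X → ¬ (v ∈ Y)) × (∀ v → v ∈ X → ¬ (v ∈ Z)) × (∀ v → v ∈ Y → ¬ (v ∈ Z))

IsIndexedPartition : ∀ {n} → Subset n → Subset n → (Fin n → Subset n) → Set
IsIndexedPartition {n} Y Z A =
  (∀ (y : Fin n) → y ∈ Y → ∀ z → z ∈ A y → z ∈ Z)
  × (∀ z → z ∈ Z → ∃[ y ] (y ∈ Y × z ∈ A y))
  × (∀ y y' z → y ∈ Y → y' ∈ Y → z ∈ A y → z ∈ A y' → y ≡ y')

_∈₃_ : ∀ {n} → Fin n → Fin n × Fin n × Fin n → Set
x ∈₃ (a , b , c) = x ≡ a ⊎ x ≡ b ⊎ x ≡ c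

FormII : ∀ {n} → Subset n → (Fin n → Subset n) → Fin n → Fin n → Fin n → Fin n → Set
FormII Y A y a b c =
  y ∈ Y × y ∈₃ (a , b , c)
  × (∀ x → x ∈₃ (a , b , c) → x ∈ Y → x ≡ y)
  × (∀ x → x ∈₃ (a , b , c) → x ≢ y → x ∈ A y)

module Submission where

-- Let W be the vertex set of the 13-core, so every vertex has degree ≥ 13 in
-- H[W].  Call z a leaf of y if z ≠ y and every triple of H[W] at z contains y.
-- The partition is: Y = vertices having a leaf, Z = leaves, A y = leaves of y,
-- X = the remaining vertices of W.  The argument runs as follows.
--  (1) Messy-freeness: if abc, bcd, def are triples and a ≠ d, then {e,f}
--      meets {a,b,c}  (messy-meet).
--  (2) If the pair {d,u} lies in at least four triples and dux is a triple,
--      then all triples at x contain d, or all contain u; otherwise some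
--      vertex would have all its ≥ 13 triples inside five pairs  (heavy-pins).
--  (3) Leaves: a leaf has a unique centre, the third vertex of a triple
--      through a leaf and its centre is again a leaf, no centre is a leaf,
--      and a pair in four triples contains a leaf.
--  (4) Two triples abc, abc' with c ≠ c' force a leaf among a, b, c, c':
--      by (1) the ≥ 13 triples at c' meet {a,b,c}, so some pair {c',u} lies in
--      four triples and (3) applies  (no-fork).
-- Then H[X ∪ Y] is a partial Steiner triple system by (4), and a triple with
-- a leaf z of y consists of y and two leaves of y by (3), i.e. has form (ii).

open import Defs
open import Data.Bool using (Bool; T; true; _∧_)
open import Data.Bool.Properties using (T-∧; T-≡)
open import Data.Empty using (⊥; ⊥-elim)
open import Data.Fin using (Fin; toℕ; _≟_)
open import Data.Fin.Properties using (all?; any?; ¬∀⟶∃¬)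
open import Data.Fin.Subset using (Subset; _∈_; _∪_)
open import Data.Fin.Subset.Properties using (_∈?_; x∈p∪q⁺; x∈p∪q⁻)
open import Data.List using (List; []; _∷_; length; filter; filterᵇ; map; allFin; cartesianProduct; _++_)
open import Data.List.Properties using (filter-notAll; filter-all; length-map; length-++)
open import Data.List.Membership.Propositional using () renaming (_∈_ to _∈ₗ_; _∉_ to _∉ₗ_)
open import Data.List.Membership.Propositional.Properties using (∈-filter⁺; ∈-filter⁻; ∈-map⁻; ∈-++⁺ˡ; ∈-++⁺ʳ)
import Data.List.Membership.DecPropositional as DecMembership
open import Data.List.Relation.Unary.All as All using ()
open import Data.List.Relation.Unary.All.Properties using () renaming (map⁺ to All-map⁺)
open import Data.List.Relation.Unary.Any as Any using (here; there)
open import Data.List.Relation.Unary.AllPairs using ([]; _∷_)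
open import Data.List.Relation.Unary.Unique.Propositional using (Unique)
import Data.List.Relation.Unary.Unique.Propositional.Properties as Unique
open import Data.Nat using (ℕ; suc; _<ᵇ_; _≤_; _<_; z≤n; s≤s; _+_; _*_)
open import Data.Nat.Properties using (≤-trans; ≤-reflexive; ≤-pred; <-≤-trans; ≮⇒≥; ≰⇒>; <-asym; *-suc; *-monoʳ-≤; +-mono-≤; n≤1+n; m≤m+n; _≤?_; <ᵇ⇒<)
open import Data.Product using (_×_; _,_; Σ; ∃-syntax; proj₁; proj₂)
open import Data.Product.Properties using (≡-dec)
open import Data.Sum using (_⊎_; inj₁; inj₂) renaming (swap to ⊎-swap)
open import Data.Vec using (lookup; tabulate)
open import Data.Vec.Properties using (lookup∘tabulate; lookup⇒[]=; []=⇒lookup)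
open import Function.Bundles using (Equivalence)
open import Relation.Binary.Definitions using (DecidableEquality)
open import Relation.Binary.PropositionalEquality using (_≡_; _≢_; refl; sym; trans; cong; subst)
open import Relation.Nullary using (¬_; Dec; yes; no; ¬?; T?)
open import Relation.Nullary.Decidable using (_×-dec_; _⊎-dec_; _→-dec_; isYes; toWitness; fromWitness; from-no)
open import Relation.Unary using (Decidable)

open Equivalence using (to; from)

module Counting {A : Set} (_≟ₐ_ : DecidableEquality A) where
  open DecMembership _≟ₐ_ using () renaming (_∈?_ to _∈ₗ?_)

  delete-shorter : ∀ {x} (Q : List A) → x ∈ₗ Q → length (filter (λ y → ¬? (y ≟ₐ x)) Q) < length Q
  delete-shorter Q x∈Q = filter-notAll (λ y → ¬? (y ≟ₐ _)) Q (Any.map (λ x≡y y≢x → y≢x (sym x≡y)) x∈Q)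

  escape : ∀ (xs Q : List A) → Unique xs → length Q < length xs → ∃[ x ] (x ∈ₗ xs × x ∉ₗ Q)
  escape (x ∷ xs) Q (x∉xs ∷ xs!) len with x ∈ₗ? Q
  ... | no x∉Q = x , here refl , x∉Q
  ... | yes x∈Q
    with escape xs (filter (λ y → ¬? (y ≟ₐ x)) Q) xs! (<-≤-trans (delete-shorter Q x∈Q) (≤-pred len))
  ...   | y , y∈xs , y∉Q-x = y , there y∈xs , λ y∈Q →
          y∉Q-x (∈-filter⁺ (λ z → ¬? (z ≟ₐ x)) y∈Q (λ y≡x → All.lookup x∉xs y∈xs (sym y≡x)))

  unique-⊆-length : ∀ {xs ys : List A} → Unique xs → (∀ {x} → x ∈ₗ xs → x ∈ₗ ys)
    → length xs ≤ length ys
  unique-⊆-length {xs} {ys} xs! xs⊆ys = ≮⇒≥ λ longer →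
    let (x , x∈xs , x∉ys) = escape xs ys xs! longer in x∉ys (xs⊆ys x∈xs)

map-unique-on : ∀ {A B : Set} {xs : List A} (f : A → B)
  → (∀ {x y} → x ∈ₗ xs → y ∈ₗ xs → f x ≡ f y → x ≡ y) → Unique xs → Unique (map f xs)
map-unique-on f inj [] = []
map-unique-on f inj (x∉xs ∷ xs!) =
  All-map⁺ (All.tabulate λ y∈xs fx≡fy → All.lookup x∉xs y∈xs (inj (here refl) (there y∈xs) fx≡fy))
  ∷ map-unique-on f (λ x∈ y∈ → inj (there x∈) (there y∈)) xs!

bothWays : ∀ {A : Set} → List (A × A) → List (A × A)
bothWays [] = []
bothWays ((a , b) ∷ Q) = (a , b) ∷ (b , a) ∷ bothWays Q

∈-bothWays : ∀ {A : Set} {a b : A} (Q : List (A × A))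
  → (a , b) ∈ₗ Q ⊎ (b , a) ∈ₗ Q → (a , b) ∈ₗ bothWays Q
∈-bothWays (_ ∷ Q) (inj₁ (here refl)) = here refl
∈-bothWays (_ ∷ Q) (inj₁ (there m)) = there (there (∈-bothWays Q (inj₁ m)))
∈-bothWays (_ ∷ Q) (inj₂ (here refl)) = there (here refl)
∈-bothWays (_ ∷ Q) (inj₂ (there m)) = there (there (∈-bothWays Q (inj₂ m)))

length-bothWays : ∀ {A : Set} (Q : List (A × A)) → length (bothWays Q) ≡ 2 * length Q
length-bothWays [] = refl
length-bothWays (_ ∷ Q) = trans (cong (λ k → suc (suc k)) (length-bothWays Q)) (sym (*-suc 2 (length Q)))

one-of-three-≥4 : ∀ a b c → 13 ≤ a + (b + c) → 4 ≤ a ⊎ 4 ≤ b ⊎ 4 ≤ c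
one-of-three-≥4 a b c sum with 4 ≤? a | 4 ≤? b | 4 ≤? c
... | yes a≥4 | _ | _ = inj₁ a≥4
... | no _ | yes b≥4 | _ = inj₂ (inj₁ b≥4)
... | no _ | no _ | yes c≥4 = inj₂ (inj₂ c≥4)
... | no a<4 | no b<4 | no c<4 =
  ⊥-elim (from-no (13 ≤? 9) (≤-trans sum (+-mono-≤ (≤3 a<4) (+-mono-≤ (≤3 b<4) (≤3 c<4)))))
  where
    ≤3 : ∀ {m} → ¬ 4 ≤ m → m ≤ 3
    ≤3 m<4 = ≤-pred (≰⇒> m<4)

ordered-pair-unique : ∀ {n} {y c a b a' b' : Fin n} → toℕ a < toℕ b → toℕ a' < toℕ b'
  → (a ≡ y × b ≡ c) ⊎ (b ≡ y × a ≡ c) → (a' ≡ y × b' ≡ c) ⊎ (b' ≡ y × a' ≡ c)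
  → (a , b) ≡ (a' , b')
ordered-pair-unique _ _ (inj₁ (refl , refl)) (inj₁ (refl , refl)) = refl
ordered-pair-unique lt lt' (inj₁ (refl , refl)) (inj₂ (refl , refl)) = ⊥-elim (<-asym lt lt')
ordered-pair-unique lt lt' (inj₂ (refl , refl)) (inj₁ (refl , refl)) = ⊥-elim (<-asym lt lt')
ordered-pair-unique _ _ (inj₂ (refl , refl)) (inj₂ (refl , refl)) = refl

select : ∀ {n} {P : Fin n → Set} → Decidable P → Subset n
select P? = tabulate (λ i → isYes (P? i))

∈-select⁺ : ∀ {n} {P : Fin n → Set} (P? : Decidable P) {i} → P i → i ∈ select P?
∈-select⁺ P? {i} p = lookup⇒[]= i _ (trans (lookup∘tabulate _ i) (to T-≡ (fromWitness p)))

∈-select⁻ : ∀ {n} {P : Fin n → Set} (P? : Decidable P) {i} → i ∈ select P? → P i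
∈-select⁻ P? {i} i∈ = toWitness (from T-≡ (trans (sym (lookup∘tabulate _ i)) ([]=⇒lookup i∈)))

_∈₂_ : ∀ {n} → Fin n → Fin n × Fin n → Set
x ∈₂ (a , b) = x ≡ a ⊎ x ≡ b

_∈₂?_ : ∀ {n} (x : Fin n) (t : Fin n × Fin n) → Dec (x ∈₂ t)
x ∈₂? (a , b) = (x ≟ a) ⊎-dec (x ≟ b)

_∈₃?_ : ∀ {n} (x : Fin n) (t : Fin n × Fin n × Fin n) → Dec (x ∈₃ t)
x ∈₃? (a , b , c) = (x ≟ a) ⊎-dec (x ∈₂? (b , c))

∈₃-swap₁₂ : ∀ {n} {x a b c : Fin n} → x ∈₃ (a , b , c) → x ∈₃ (b , a , c)
∈₃-swap₁₂ (inj₁ p) = inj₂ (inj₁ p)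
∈₃-swap₁₂ (inj₂ (inj₁ p)) = inj₁ p
∈₃-swap₁₂ (inj₂ (inj₂ p)) = inj₂ (inj₂ p)

∈₃-swap₂₃ : ∀ {n} {x a b c : Fin n} → x ∈₃ (a , b , c) → x ∈₃ (a , c , b)
∈₃-swap₂₃ (inj₁ p) = inj₁ p
∈₃-swap₂₃ (inj₂ (inj₁ p)) = inj₂ (inj₂ p)
∈₃-swap₂₃ (inj₂ (inj₂ p)) = inj₂ (inj₁ p)

∈₃-rotate : ∀ {n} {x a b c : Fin n} → x ∈₃ (a , b , c) → x ∈₃ (b , c , a)
∈₃-rotate (inj₁ p) = inj₂ (inj₂ p)
∈₃-rotate (inj₂ (inj₁ p)) = inj₁ p
∈₃-rotate (inj₂ (inj₂ p)) = inj₂ (inj₁ p)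

formII-perm : ∀ {n} (Y : Subset n) (A : Fin n → Subset n) {y a b c a' b' c'}
  → (∀ {x} → x ∈₃ (a , b , c) → x ∈₃ (a' , b' , c'))
  → (∀ {x} → x ∈₃ (a' , b' , c') → x ∈₃ (a , b , c))
  → FormII Y A y a b c → FormII Y A y a' b' c'
formII-perm _ _ to' from' (y∈Y , y∈ , only-y , rest-in-A) =
  y∈Y , to' y∈ , (λ x x∈ → only-y x (from' x∈)) , (λ x x∈ → rest-in-A x (from' x∈))

core-min-degree : ∀ {n} {H : Hypergraph3 n} {m U W} → CoreSeq H m U W → ∀ v → v ∈ W → m ≤ degIn H W v
core-min-degree (done deg) = deg
core-min-degree (step _ _ _ rest) = core-min-degree rest

module LinkOf {n : ℕ} (H : Hypergraph3 n) (W : Subset n) where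
  open Counting (≡-dec (_≟_ {n}) (_≟_ {n})) using (escape; unique-⊆-length)

  E : Fin n → Fin n → Fin n → Set
  E = EdgeIn H W

  swap₁₂ : ∀ {a b c} → E a b c → E b a c
  swap₁₂ {a} {b} {c} (abc , a∈ , b∈ , c∈) = trans (sym₁₂ H b a c) abc , b∈ , a∈ , c∈

  swap₂₃ : ∀ {a b c} → E a b c → E a c b
  swap₂₃ {a} {b} {c} (abc , a∈ , b∈ , c∈) = trans (sym₂₃ H a c b) abc , a∈ , c∈ , b∈

  rotate : ∀ {a b c} → E a b c → E b c a
  rotate abc = swap₂₃ (swap₁₂ abc)

  rotate² : ∀ {a b c} → E a b c → E c a b
  rotate² abc = rotate (rotate abc)

  swap₁₃ : ∀ {a b c} → E a b c → E c b a
  swap₁₃ abc = swap₁₂ (rotate abc)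

  ≢₁₂ : ∀ {a b c} → E a b c → a ≢ b
  ≢₁₂ {a} {b} {c} (abc , _) = proj₁ (distinct H a b c abc)

  ≢₂₃ : ∀ {a b c} → E a b c → b ≢ c
  ≢₂₃ abc = ≢₁₂ (rotate abc)

  ≢₁₃ : ∀ {a b c} → E a b c → a ≢ c
  ≢₁₃ abc = ≢₁₂ (swap₂₃ abc)

  ∈W₂ : ∀ {a b c} → E a b c → b ∈ W
  ∈W₂ (_ , _ , b∈ , _) = b∈

  ∈W₃ : ∀ {a b c} → E a b c → c ∈ W
  ∈W₃ (_ , _ , _ , c∈) = c∈

  E? : ∀ a b c → Dec (E a b c)
  E? a b c = (edge H a b c Data.Bool.≟ true) ×-dec (a ∈? W) ×-dec (b ∈? W) ×-dec (c ∈? W)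

  -- The link of v: pairs (a , b) with a < b and vab a triple of H[W].  Its
  -- length is, by definition, the degree of v in H[W].
  linked : Fin n → Fin n × Fin n → Bool
  linked v (a , b) = lookup W v ∧ lookup W a ∧ lookup W b ∧ (toℕ a <ᵇ toℕ b) ∧ edge H v a b

  Link : Fin n → List (Fin n × Fin n)
  Link v = filterᵇ (linked v) (cartesianProduct (allFin n) (allFin n))

  link-unique : ∀ v → Unique (Link v)
  link-unique v = Unique.filter⁺ _ (Unique.cartesianProduct⁺ (Unique.allFin⁺ n) (Unique.allFin⁺ n))

  link-member : ∀ {v a b} → (a , b) ∈ₗ Link v → E v a b × toℕ a < toℕ b
  link-member {v} {a} {b} m
    with to T-∧ (proj₂ (∈-filter⁻ (λ p → T? (linked v p)) {xs = cartesianProduct (allFin n) (allFin n)} m))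
  ... | v∈ , rest with to T-∧ rest
  ... | a∈ , rest with to T-∧ rest
  ... | b∈ , rest with to T-∧ rest
  ... | a<b , vab = (to T-≡ vab , ∈W v∈ , ∈W a∈ , ∈W b∈) , <ᵇ⇒< (toℕ a) (toℕ b) a<b
    where
      ∈W : ∀ {x} → T (lookup W x) → x ∈ W
      ∈W {x} t = lookup⇒[]= x W (to T-≡ t)

  some-triple : ∀ {v} → 0 < degIn H W v → ∃[ a ] ∃[ b ] E v a b
  some-triple {v} positive with escape (Link v) [] (link-unique v) positive
  ... | (a , b) , m , _ = a , b , proj₁ (link-member m)

  Covers : Fin n → List (Fin n × Fin n) → Set
  Covers v Q = ∀ a b → E v a b → (a , b) ∈ₗ Q ⊎ (b , a) ∈ₗ Q

  covered-degree : ∀ {v} Q → Covers v Q → degIn H W v ≤ 2 * length Q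
  covered-degree {v} Q covers = ≤-trans
    (unique-⊆-length (link-unique v) (λ m → ∈-bothWays Q (covers _ _ (proj₁ (link-member m)))))
    (≤-reflexive (length-bothWays Q))

  Through : Fin n → Fin n × Fin n → Set
  Through y (a , b) = a ≡ y ⊎ b ≡ y

  through? : ∀ y p → Dec (Through y p)
  through? y (a , b) = (a ≟ y) ⊎-dec (b ≟ y)

  CoLink : Fin n → Fin n → List (Fin n × Fin n)
  CoLink v y = filter (through? y) (Link v)

  coLinks-cover : ∀ {v u₁ u₂ u₃} → (∀ s t → E v s t → s ∈₃ (u₁ , u₂ , u₃) ⊎ t ∈₃ (u₁ , u₂ , u₃))
    → degIn H W v ≤ length (CoLink v u₁) + (length (CoLink v u₂) + length (CoLink v u₃))
  coLinks-cover {v} {u₁} {u₂} {u₃} meets = ≤-trans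
    (unique-⊆-length (link-unique v) place)
    (≤-reflexive (trans (length-++ (CoLink v u₁)) (cong (length (CoLink v u₁) +_) (length-++ (CoLink v u₂)))))
    where
      sort : ∀ {s t} → s ∈₃ (u₁ , u₂ , u₃) ⊎ t ∈₃ (u₁ , u₂ , u₃)
           → Through u₁ (s , t) ⊎ Through u₂ (s , t) ⊎ Through u₃ (s , t)
      sort (inj₁ (inj₁ p)) = inj₁ (inj₁ p)
      sort (inj₁ (inj₂ (inj₁ p))) = inj₂ (inj₁ (inj₁ p))
      sort (inj₁ (inj₂ (inj₂ p))) = inj₂ (inj₂ (inj₁ p))
      sort (inj₂ (inj₁ p)) = inj₁ (inj₂ p)
      sort (inj₂ (inj₂ (inj₁ p))) = inj₂ (inj₁ (inj₂ p))
      sort (inj₂ (inj₂ (inj₂ p))) = inj₂ (inj₂ (inj₂ p))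
      place : ∀ {p} → p ∈ₗ Link v → p ∈ₗ CoLink v u₁ ++ CoLink v u₂ ++ CoLink v u₃
      place {s , t} m with sort (meets s t (proj₁ (link-member m)))
      ... | inj₁ th = ∈-++⁺ˡ (∈-filter⁺ (through? u₁) m th)
      ... | inj₂ (inj₁ th) = ∈-++⁺ʳ (CoLink v u₁) (∈-++⁺ˡ (∈-filter⁺ (through? u₂) m th))
      ... | inj₂ (inj₂ th) = ∈-++⁺ʳ (CoLink v u₁) (∈-++⁺ʳ (CoLink v u₂) (∈-filter⁺ (through? u₃) m th))

  other : Fin n → Fin n × Fin n → Fin n
  other y (a , b) with a ≟ y
  ... | yes _ = b
  ... | no _ = a

  other-spec : ∀ {y a b} → Through y (a , b) → (a ≡ y × b ≡ other y (a , b)) ⊎ (b ≡ y × a ≡ other y (a , b))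
  other-spec {y} {a} {b} through with a ≟ y | through
  ... | yes a≡y | _ = inj₁ (a≡y , refl)
  ... | no a≢y | inj₁ a≡y = ⊥-elim (a≢y a≡y)
  ... | no _ | inj₂ b≡y = inj₂ (b≡y , refl)

  CoNbrs : Fin n → Fin n → List (Fin n)
  CoNbrs v y = map (other y) (CoLink v y)

  coNbrs-member : ∀ {v y x} → x ∈ₗ CoNbrs v y → E v y x
  coNbrs-member {v} {y} m with ∈-map⁻ (other y) m
  ... | _ , p∈ , x≡other with ∈-filter⁻ (through? y) p∈
  ... | p∈Link , through = orient (other-spec through) x≡other (proj₁ (link-member p∈Link))
    where
      orient : ∀ {a b c x} → (a ≡ y × b ≡ c) ⊎ (b ≡ y × a ≡ c) → x ≡ c → E v a b → E v y x
      orient (inj₁ (refl , refl)) refl vab = vab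
      orient (inj₂ (refl , refl)) refl vab = swap₂₃ vab

  coNbrs-unique : ∀ v y → Unique (CoNbrs v y)
  coNbrs-unique v y = map-unique-on (other y) injective (Unique.filter⁺ (through? y) (link-unique v))
    where
      injective : ∀ {p q} → p ∈ₗ CoLink v y → q ∈ₗ CoLink v y → other y p ≡ other y q → p ≡ q
      injective {a , b} {a' , b'} p∈ q∈ same with ∈-filter⁻ (through? y) p∈ | ∈-filter⁻ (through? y) q∈
      ... | p∈Link , tp | q∈Link , tq =
        ordered-pair-unique (proj₂ (link-member p∈Link)) (proj₂ (link-member q∈Link))
          (other-spec tp) (subst (λ c → (a' ≡ y × b' ≡ c) ⊎ (b' ≡ y × a' ≡ c)) (sym same) (other-spec tq))

  Pinned : Fin n → Fin n → Set
  Pinned x y = ∀ a b → E x a b → Through y (a , b)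

  pinned? : ∀ x y → Dec (Pinned x y)
  pinned? x y = all? λ a → all? λ b → E? x a b →-dec through? y (a , b)

  unpinned-triple : ∀ {x y} → ¬ Pinned x y → ∃[ a ] ∃[ b ] (E x a b × a ≢ y × b ≢ y)
  unpinned-triple {x} {y} ¬pinned with ¬∀⟶∃¬ n _ (λ a → all? λ b → E? x a b →-dec through? y (a , b)) ¬pinned
  ... | a , ¬pinned-a with ¬∀⟶∃¬ n _ (λ b → E? x a b →-dec through? y (a , b)) ¬pinned-a
  ... | b , ¬pinned-ab with E? x a b
  ... | no ¬xab = ⊥-elim (¬pinned-ab λ xab → ⊥-elim (¬xab xab))
  ... | yes xab = a , b , xab , (λ a≡y → ¬pinned-ab λ _ → inj₁ a≡y)
                           , (λ b≡y → ¬pinned-ab λ _ → inj₂ b≡y)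

  pinned-coLink : ∀ {v y} → Pinned v y → CoLink v y ≡ Link v
  pinned-coLink {v} {y} pinned =
    filter-all (through? y) (All.tabulate λ m → pinned _ _ (proj₁ (link-member m)))

module MessyFreeCore {n : ℕ} (H : Hypergraph3 n) (messy-free : ¬ ContainsMessyPath H) (W : Subset n)
                     (min-degree : ∀ v → v ∈ W → 13 ≤ degIn H W v) where
  open LinkOf H W public
  open Counting (_≟_ {n}) using (escape)

  messy-meet : ∀ {a b c d e f} → E a b c → E b c d → a ≢ d → E d e f
    → e ∈₃ (a , b , c) ⊎ f ∈₃ (a , b , c)
  messy-meet {a} {b} {c} {d} {e} {f} abc bcd a≢d def with e ∈₃? (a , b , c) | f ∈₃? (a , b , c)
  ... | yes e∈ | _ = inj₁ e∈
  ... | no _ | yes f∈ = inj₂ f∈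
  ... | no e∉ | no f∉ =
    ⊥-elim (messy-free (a , b , c , d , e , f , six-distinct , proj₁ abc , proj₁ bcd , proj₁ def))
    where
      apart : ∀ {x} → ¬ x ∈₃ (a , b , c) → (a ≢ x) × (b ≢ x) × (c ≢ x)
      apart x∉ = (λ p → x∉ (inj₁ (sym p))) , (λ p → x∉ (inj₂ (inj₁ (sym p))))
                 , (λ p → x∉ (inj₂ (inj₂ (sym p))))
      six-distinct : Unique (a ∷ b ∷ c ∷ d ∷ e ∷ f ∷ [])
      six-distinct =
        let (a≢e , b≢e , c≢e) = apart e∉ ; (a≢f , b≢f , c≢f) = apart f∉ in
          (≢₁₂ abc All.∷ ≢₁₃ abc All.∷ a≢d All.∷ a≢e All.∷ a≢f All.∷ All.[])
        ∷ (≢₂₃ abc All.∷ ≢₁₃ bcd All.∷ b≢e All.∷ b≢f All.∷ All.[])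
        ∷ (≢₂₃ bcd All.∷ c≢e All.∷ c≢f All.∷ All.[])
        ∷ (≢₁₂ def All.∷ ≢₁₃ def All.∷ All.[])
        ∷ (≢₂₃ def All.∷ All.[])
        ∷ All.[] ∷ []

  -- No vertex of W is covered by six pairs: its degree is at least 13 > 12.
  sparse : ∀ {v} Q → v ∈ W → length Q ≤ 6 → ¬ Covers v Q
  sparse Q v∈W small covers = from-no (13 ≤? 12)
    (≤-trans (min-degree _ v∈W) (≤-trans (covered-degree Q covers) (*-monoʳ-≤ 2 small)))

  -- The pair {d,u} lies in at least four triples, witnessed by a list of
  -- distinct third vertices.
  Heavy : Fin n → Fin n → Set
  Heavy d u = Σ (List (Fin n)) λ xs → Unique xs × 4 ≤ length xs × (∀ {x} → x ∈ₗ xs → E d u x)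

  heavy-sym : ∀ {d u} → Heavy d u → Heavy u d
  heavy-sym (xs , xs! , four , common) = xs , xs! , four , λ m → swap₁₂ (common m)

  heavy-from-coLink : ∀ {v y} → 4 ≤ length (CoLink v y) → Heavy v y
  heavy-from-coLink {v} {y} four =
    CoNbrs v y , coNbrs-unique v y , subst (4 ≤_) (sym (length-map (other y) (CoLink v y))) four , coNbrs-member

  heavy-triple : ∀ {d u} → Heavy d u → ∃[ x ] E d u x
  heavy-triple (x ∷ _ , _ , _ , common) = x , common (here refl)

  -- Every triple at a common neighbour x of a heavy pair {d,u} meets {d,u}:
  -- otherwise another common neighbour y gives the messy path ydu, dux, xst.
  heavy-meets : ∀ {d u x s t} → Heavy d u → E d u x → E x s t → s ∈₂ (d , u) ⊎ t ∈₂ (d , u)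
  heavy-meets {d} {u} {x} {s} {t} (xs , xs! , four , common) dux xst
    with (s ∈₂? (d , u)) ⊎-dec (t ∈₂? (d , u))
  ... | yes meets = meets
  ... | no ¬meets with escape xs (x ∷ s ∷ t ∷ []) xs! four
  ...   | y , y∈xs , y∉xst with messy-meet (rotate² (common y∈xs)) dux (λ y≡x → y∉xst (here y≡x)) xst
  ...     | inj₁ (inj₁ s≡y) = ⊥-elim (y∉xst (there (here (sym s≡y))))
  ...     | inj₁ (inj₂ s∈du) = ⊥-elim (¬meets (inj₁ s∈du))
  ...     | inj₂ (inj₁ t≡y) = ⊥-elim (y∉xst (there (there (here (sym t≡y)))))
  ...     | inj₂ (inj₂ t∈du) = ⊥-elim (¬meets (inj₂ t∈du))

  leaning : ∀ {d u x} → Heavy d u → E d u x → ¬ Pinned x d → ∃[ q ] (E x u q × q ≢ d)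
  leaning heavy dux ¬pinned with unpinned-triple ¬pinned
  ... | a , b , xab , a≢d , b≢d with heavy-meets heavy dux xab
  ...   | inj₁ (inj₁ a≡d) = ⊥-elim (a≢d a≡d)
  ...   | inj₁ (inj₂ refl) = b , xab , b≢d
  ...   | inj₂ (inj₁ b≡d) = ⊥-elim (b≢d b≡d)
  ...   | inj₂ (inj₂ refl) = a , swap₂₃ xab , a≢d

  -- Given triples dux, xuq, xdp (q ≠ d, p ≠ u), a further common neighbour y
  -- of the heavy pair {d,u} has all triples among the five pairs
  -- du, dq, dx, up, ux — impossible in the core.
  crowded : ∀ {d u x p q y} → Heavy d u → E d u x → E x u q → q ≢ d → E x d p → p ≢ u
    → E d u y → y ≢ x → y ≢ p → y ≢ q → ⊥
  crowded {d} {u} {x} {p} {q} {y} heavy dux xuq q≢d xdp p≢u duy y≢x y≢p y≢q =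
    sparse five (∈W₃ duy) (n≤1+n 5) covered
    where
      five : List (Fin n × Fin n)
      five = (d , u) ∷ (d , q) ∷ (d , x) ∷ (u , p) ∷ (u , x) ∷ []
      -- (1) for the triples q u x, u x d (q ≠ d) gives b ∈ {q, u, x}
      via-d : ∀ {b} → E d y b → (d , b) ∈ₗ five
      via-d dyb with messy-meet (swap₁₃ xuq) (rotate dux) q≢d dyb
      ... | inj₁ (inj₁ y≡q) = ⊥-elim (y≢q y≡q)
      ... | inj₁ (inj₂ (inj₁ y≡u)) = ⊥-elim (≢₂₃ duy (sym y≡u))
      ... | inj₁ (inj₂ (inj₂ y≡x)) = ⊥-elim (y≢x y≡x)
      ... | inj₂ (inj₁ refl) = there (here refl)
      ... | inj₂ (inj₂ (inj₁ refl)) = here refl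
      ... | inj₂ (inj₂ (inj₂ refl)) = there (there (here refl))
      -- (1) for the triples p d x, d x u (p ≠ u) gives b ∈ {p, d, x}
      via-u : ∀ {b} → E u y b → (u , b) ∈ₗ five ⊎ (b , u) ∈ₗ five
      via-u uyb with messy-meet (swap₁₃ xdp) (swap₂₃ dux) p≢u uyb
      ... | inj₁ (inj₁ y≡p) = ⊥-elim (y≢p y≡p)
      ... | inj₁ (inj₂ (inj₁ y≡d)) = ⊥-elim (≢₁₃ duy (sym y≡d))
      ... | inj₁ (inj₂ (inj₂ y≡x)) = ⊥-elim (y≢x y≡x)
      ... | inj₂ (inj₁ refl) = inj₁ (there (there (there (here refl))))
      ... | inj₂ (inj₂ (inj₁ refl)) = inj₂ (here refl)
      ... | inj₂ (inj₂ (inj₂ refl)) = inj₁ (there (there (there (there (here refl)))))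
      covered : Covers y five
      covered a b yab with heavy-meets heavy duy yab
      ... | inj₁ (inj₁ refl) = inj₁ (via-d (swap₁₂ yab))
      ... | inj₁ (inj₂ refl) = via-u (swap₁₂ yab)
      ... | inj₂ (inj₁ refl) = inj₂ (via-d (rotate² yab))
      ... | inj₂ (inj₂ refl) = ⊎-swap (via-u (rotate² yab))

  heavy-pins : ∀ {d u x} → Heavy d u → E d u x → Pinned x d ⊎ Pinned x u
  heavy-pins {d} {u} {x} heavy@(xs , xs! , four , common) dux with pinned? x d | pinned? x u
  ... | yes pinned | _ = inj₁ pinned
  ... | no _ | yes pinned = inj₂ pinned
  ... | no ¬d | no ¬u with leaning heavy dux ¬d | leaning (heavy-sym heavy) (swap₁₂ dux) ¬u
  ... | q , xuq , q≢d | p , xdp , p≢u with escape xs (x ∷ p ∷ q ∷ []) xs! four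
  ... | y , y∈xs , y∉xpq = ⊥-elim (crowded heavy dux xuq q≢d xdp p≢u (common y∈xs)
        (λ e → y∉xpq (here e)) (λ e → y∉xpq (there (here e))) (λ e → y∉xpq (there (there (here e)))))

  Leaf : Fin n → Fin n → Set
  Leaf z y = z ∈ W × z ≢ y × Pinned z y

  leaf? : ∀ z y → Dec (Leaf z y)
  leaf? z y = (z ∈? W) ×-dec ¬? (z ≟ y) ×-dec pinned? z y

  pinned-leaf : ∀ {y u x} → E y u x → Pinned x y → Leaf x y
  pinned-leaf yux pinned = ∈W₃ yux , (λ x≡y → ≢₁₃ yux (sym x≡y)) , pinned

  NotLeaf : Fin n → Set
  NotLeaf v = ∀ y → ¬ Leaf v y

  -- A leaf and its centre lie in all ≥ 13 triples at the leaf.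
  leaf-heavy : ∀ {z y} → Leaf z y → Heavy y z
  leaf-heavy {z} (z∈W , _ , pinned) = heavy-sym (heavy-from-coLink
    (subst (4 ≤_) (sym (cong length (pinned-coLink pinned))) (≤-trans (m≤m+n 4 9) (min-degree z z∈W))))

  leaf-triple : ∀ {z y} → Leaf z y → ∃[ b ] E z y b
  leaf-triple (z∈W , _ , pinned) with some-triple (≤-trans (s≤s z≤n) (min-degree _ z∈W))
  ... | a , b , zab with pinned a b zab
  ...   | inj₁ refl = b , zab
  ...   | inj₂ refl = a , swap₂₃ zab

  leaf-spread : ∀ {z y w} → Leaf z y → E y z w → Leaf w y
  leaf-spread {z} {y} {w} leaf@(_ , _ , z-pinned) yzw with heavy-pins (leaf-heavy leaf) yzw
  ... | inj₁ w-pinned = pinned-leaf yzw w-pinned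
  ... | inj₂ w-pinned = ⊥-elim (sparse ((y , z) ∷ []) (∈W₃ yzw) (s≤s z≤n) covered)
    where
      covered : Covers w ((y , z) ∷ [])
      covered a b wab with w-pinned a b wab
      ... | inj₁ refl with z-pinned w b (swap₁₂ wab)
      ...   | inj₁ w≡y = ⊥-elim (≢₁₃ yzw (sym w≡y))
      ...   | inj₂ refl = inj₂ (here refl)
      covered a b wab | inj₂ refl with z-pinned w a (rotate² wab)
      ...   | inj₁ w≡y = ⊥-elim (≢₁₃ yzw (sym w≡y))
      ...   | inj₂ refl = inj₁ (here refl)

  leaf-unique : ∀ {z y y'} → Leaf z y → Leaf z y' → y ≡ y'
  leaf-unique {z} {y} {y'} (z∈W , _ , pinned) (_ , _ , pinned') with y ≟ y'
  ... | yes y≡y' = y≡y'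
  ... | no y≢y' = ⊥-elim (sparse ((y , y') ∷ []) z∈W (s≤s z≤n) covered)
    where
      covered : Covers z ((y , y') ∷ [])
      covered a b zab with pinned a b zab | pinned' a b zab
      ... | inj₁ refl | inj₁ y≡y' = ⊥-elim (y≢y' y≡y')
      ... | inj₁ refl | inj₂ refl = inj₁ (here refl)
      ... | inj₂ refl | inj₁ refl = inj₂ (here refl)
      ... | inj₂ refl | inj₂ y≡y' = ⊥-elim (y≢y' y≡y')

  centre-not-leaf : ∀ {z y y'} → Leaf z y → ¬ Leaf y y'
  centre-not-leaf {z} {y} {y'} z-leaf@(z∈W , z≢y , z-pinned) y-leaf@(_ , _ , y-pinned) with z ≟ y'
  ... | yes refl = let (b , zyb) = leaf-triple z-leaf in
        z≢y (sym (leaf-unique (leaf-spread z-leaf (swap₁₂ zyb)) (leaf-spread y-leaf zyb)))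
  ... | no z≢y' = sparse ((y , y') ∷ []) z∈W (s≤s z≤n) covered
    where
      covered : Covers z ((y , y') ∷ [])
      covered a b zab with z-pinned a b zab
      ... | inj₁ refl with y-pinned z b (swap₁₂ zab)
      ...   | inj₁ z≡y' = ⊥-elim (z≢y' z≡y')
      ...   | inj₂ refl = inj₁ (here refl)
      covered a b zab | inj₂ refl with y-pinned z a (rotate² zab)
      ...   | inj₁ z≡y' = ⊥-elim (z≢y' z≡y')
      ...   | inj₂ refl = inj₂ (here refl)

  heavy-has-leaf : ∀ {v u} → Heavy v u → NotLeaf v → NotLeaf u → ⊥
  heavy-has-leaf heavy ¬v-leaf ¬u-leaf with heavy-triple heavy
  ... | x , vux with heavy-pins heavy vux
  ...   | inj₁ pinned = ¬u-leaf _ (leaf-spread (pinned-leaf vux pinned) (swap₂₃ vux))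
  ...   | inj₂ pinned = ¬v-leaf _ (leaf-spread (pinned-leaf (swap₁₂ vux) pinned) (rotate vux))

  no-fork : ∀ {a b c c'} → E a b c → E a b c' → c ≢ c'
    → NotLeaf a → NotLeaf b → NotLeaf c → NotLeaf c' → ⊥
  no-fork {a} {b} {c} {c'} abc abc' c≢c' ¬a ¬b ¬c ¬c'
    with one-of-three-≥4 _ _ _ (≤-trans (min-degree c' (∈W₃ abc'))
           (coLinks-cover (λ s t → messy-meet (rotate² abc) abc' c≢c')))
  ... | inj₁ four = heavy-has-leaf (heavy-from-coLink four) ¬c' ¬c
  ... | inj₂ (inj₁ four) = heavy-has-leaf (heavy-from-coLink four) ¬c' ¬a
  ... | inj₂ (inj₂ four) = heavy-has-leaf (heavy-from-coLink four) ¬c' ¬b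

module Decomposition {n : ℕ} (H : Hypergraph3 n) (messy-free : ¬ ContainsMessyPath H) (W : Subset n)
                     (min-degree : ∀ v → v ∈ W → 13 ≤ degIn H W v) where
  open MessyFreeCore H messy-free W min-degree

  IsLeaf IsCentre IsPlain : Fin n → Set
  IsLeaf z = ∃[ y ] Leaf z y
  IsCentre y = ∃[ z ] Leaf z y
  IsPlain x = x ∈ W × ¬ IsCentre x × ¬ IsLeaf x

  isLeaf? : ∀ z → Dec (IsLeaf z)
  isLeaf? z = any? (leaf? z)

  isCentre? : ∀ y → Dec (IsCentre y)
  isCentre? y = any? (λ z → leaf? z y)

  isPlain? : ∀ x → Dec (IsPlain x)
  isPlain? x = (x ∈? W) ×-dec ¬? (isCentre? x) ×-dec ¬? (isLeaf? x)

  X Y Z : Subset n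
  X = select isPlain?
  Y = select isCentre?
  Z = select isLeaf?

  A : Fin n → Subset n
  A y = select (λ z → leaf? z y)

  leaf-not-centre : ∀ {z y} → Leaf z y → ¬ z ∈ Y
  leaf-not-centre z-leaf z∈Y =
    let (_ , z'-leaf) = ∈-select⁻ isCentre? z∈Y in centre-not-leaf z'-leaf z-leaf

  centre-in-W : ∀ {y} → y ∈ Y → y ∈ W
  centre-in-W y∈Y = ∈W₂ (proj₂ (leaf-triple (proj₂ (∈-select⁻ isCentre? y∈Y))))

  -- X, Y, Z partition W: they are disjoint by definition and by (3c).
  partition : IsPartition3 W X Y Z
  partition = exhaustive , (λ v v∈X → proj₁ (∈-select⁻ isPlain? v∈X)) , (λ v → centre-in-W)
            , (λ v v∈Z → proj₁ (proj₂ (∈-select⁻ isLeaf? v∈Z)))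
            , (λ v v∈X v∈Y → proj₁ (proj₂ (∈-select⁻ isPlain? v∈X)) (∈-select⁻ isCentre? v∈Y))
            , (λ v v∈X v∈Z → proj₂ (proj₂ (∈-select⁻ isPlain? v∈X)) (∈-select⁻ isLeaf? v∈Z))
            , (λ v v∈Y v∈Z → leaf-not-centre (proj₂ (∈-select⁻ isLeaf? v∈Z)) v∈Y)
    where
      exhaustive : ∀ v → v ∈ W → v ∈ X ⊎ v ∈ Y ⊎ v ∈ Z
      exhaustive v v∈W with isCentre? v | isLeaf? v
      ... | yes centre | _ = inj₂ (inj₁ (∈-select⁺ isCentre? centre))
      ... | no _ | yes leaf = inj₂ (inj₂ (∈-select⁺ isLeaf? leaf))
      ... | no ¬centre | no ¬leaf = inj₁ (∈-select⁺ isPlain? (v∈W , ¬centre , ¬leaf))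

  -- Every leaf has exactly one centre (3b).
  indexed-partition : IsIndexedPartition Y Z A
  indexed-partition =
      (λ y _ z z∈A → ∈-select⁺ isLeaf? (y , ∈-select⁻ (λ z → leaf? z y) z∈A))
    , (λ z z∈Z → let (y , leaf) = ∈-select⁻ isLeaf? z∈Z in
         y , ∈-select⁺ isCentre? (z , leaf) , ∈-select⁺ (λ z → leaf? z y) leaf)
    , (λ y y' z _ _ z∈A z∈A' →
         leaf-unique (∈-select⁻ (λ z → leaf? z y) z∈A) (∈-select⁻ (λ z → leaf? z y') z∈A'))

  non-leaf : ∀ {v} → v ∈ X ∪ Y → v ∈ W × NotLeaf v
  non-leaf v∈ with x∈p∪q⁻ X Y v∈
  ... | inj₁ v∈X = let (v∈W , _ , ¬leaf) = ∈-select⁻ isPlain? v∈X in v∈W , λ y leaf → ¬leaf (y , leaf)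
  ... | inj₂ v∈Y = centre-in-W v∈Y , λ y leaf → leaf-not-centre leaf v∈Y

  in-XY : ∀ {v} → v ∈ W → ¬ IsLeaf v → v ∈ X ∪ Y
  in-XY {v} v∈W ¬leaf with isCentre? v
  ... | yes centre = x∈p∪q⁺ (inj₂ (∈-select⁺ isCentre? centre))
  ... | no ¬centre = x∈p∪q⁺ (inj₁ (∈-select⁺ isPlain? (v∈W , ¬centre , ¬leaf)))

  steiner : IsPartialSTS H (X ∪ Y)
  steiner a b c c' (abc , a∈ , b∈ , c∈) (abc' , _ , _ , c'∈) with c ≟ c'
  ... | yes c≡c' = c≡c'
  ... | no c≢c' =
    let (a∈W , ¬a) = non-leaf a∈ ; (b∈W , ¬b) = non-leaf b∈
        (c∈W , ¬c) = non-leaf c∈ ; (c'∈W , ¬c') = non-leaf c'∈ in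
    ⊥-elim (no-fork (abc , a∈W , b∈W , c∈W) (abc' , a∈W , b∈W , c'∈W) c≢c' ¬a ¬b ¬c ¬c')

  leaf-triangle : ∀ {z y w} → Leaf z y → Leaf w y → FormII Y A y z y w
  leaf-triangle {z} {y} {w} z-leaf w-leaf =
    ∈-select⁺ isCentre? (z , z-leaf) , inj₂ (inj₁ refl) , only-centre , leaves
    where
      only-centre : ∀ x → x ∈₃ (z , y , w) → x ∈ Y → x ≡ y
      only-centre x (inj₁ refl) x∈Y = ⊥-elim (leaf-not-centre z-leaf x∈Y)
      only-centre x (inj₂ (inj₁ x≡y)) _ = x≡y
      only-centre x (inj₂ (inj₂ refl)) x∈Y = ⊥-elim (leaf-not-centre w-leaf x∈Y)
      leaves : ∀ x → x ∈₃ (z , y , w) → x ≢ y → x ∈ A y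
      leaves x (inj₁ refl) _ = ∈-select⁺ (λ z → leaf? z y) z-leaf
      leaves x (inj₂ (inj₁ x≡y)) x≢y = ⊥-elim (x≢y x≡y)
      leaves x (inj₂ (inj₂ refl)) _ = ∈-select⁺ (λ z → leaf? z y) w-leaf

  leaf-formII : ∀ {z y p q} → Leaf z y → E z p q → FormII Y A y z p q
  leaf-formII z-leaf@(_ , _ , pinned) zpq with pinned _ _ zpq
  ... | inj₁ refl = leaf-triangle z-leaf (leaf-spread z-leaf (swap₁₂ zpq))
  ... | inj₂ refl =
        formII-perm Y A ∈₃-swap₂₃ ∈₃-swap₂₃ (leaf-triangle z-leaf (leaf-spread z-leaf (rotate² zpq)))

  classify : ∀ a b c → E a b c
    → ((a ∈ X ∪ Y) × (b ∈ X ∪ Y) × (c ∈ X ∪ Y)) ⊎ ∃[ y ] FormII Y A y a b c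
  classify a b c abc@(_ , a∈W , b∈W , c∈W) with isLeaf? a | isLeaf? b | isLeaf? c
  ... | yes (y , a-leaf) | _ | _ = inj₂ (y , leaf-formII a-leaf abc)
  ... | no _ | yes (y , b-leaf) | _ =
        inj₂ (y , formII-perm Y A ∈₃-swap₁₂ ∈₃-swap₁₂ (leaf-formII b-leaf (swap₁₂ abc)))
  ... | no _ | no _ | yes (y , c-leaf) =
        inj₂ (y , formII-perm Y A ∈₃-rotate (λ x∈ → ∈₃-rotate (∈₃-rotate x∈))
                    (leaf-formII c-leaf (rotate² abc)))
  ... | no ¬a | no ¬b | no ¬c = inj₁ (in-XY a∈W ¬a , in-XY b∈W ¬b , in-XY c∈W ¬c)

mainTheorem5 : ∀ (n : ℕ) (H : Hypergraph3 n) → ¬ ContainsMessyPath H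
    → ∀ (W : Subset n) → IsCoreVertexSet H 13 W
    → ∃[ X ] ∃[ Y ] ∃[ Z ] Σ (Fin n → Subset n) λ A →
        IsPartition3 W X Y Z
        × IsIndexedPartition Y Z A
        × IsPartialSTS H (X ∪ Y)
        × (∀ a b c → EdgeIn H W a b c →
             ((a ∈ X ∪ Y) × (b ∈ X ∪ Y) × (c ∈ X ∪ Y))
             ⊎ ∃[ y ] FormII Y A y a b c)
mainTheorem5 n H messy-free W core =
  X , Y , Z , A , partition , indexed-partition , steiner , classify
  where open Decomposition H messy-free W (core-min-degree core)
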